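{- Let $\mathcal F$ be an algebraic language with no nullary symbols, $\mathbf I=([m];\mathcal F)$ a finite $\mathcal F$-algebra, $\mathbf A$ an $\mathcal F$-algebra with a surjective homomorphism $\chi\colon\mathbf A\to\mathbf I$, $D^{(i)}:=\chi^{ -1}(i)$, and $\mathbf C:=\mathfrak C(\mathbf A,\chi)$ with universe $C=\prod_{i\in[m]}D^{(i)}$. A function $P\colon C^k\to C$ is a $k$-ary polynomial operation of $\mathbf C$ if and only if $\mathbf A$ has $mk$-ary polynomial operations $p^{(1)},\dots,p^{(m)}$ such that for every $m\times k$ matrix $\mathbf a\in C^k$ (columns in $C$), $p^{(i)}(\mathbf a)\in D^{(i)}$ for every $i\in[m]$ and $P(\mathbf a)=(p^{(1)}(\mathbf a),\dots,p^{(m)}(\mathbf a))$, where $P$ is applied to the columns and each $p^{(i)}$ to the $mk$ entries of $\mathbf a$.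
   Context: $[m]=\{1,\dots,m\}$. $\mathfrak C(\mathbf A,\chi)$ has universe $C$ (columns $\mathbf c=(c^{(1)},\dots,c^{(m)})$), an $m$-ary operation $d(\mathbf c_1,\dots,\mathbf c_m)=(c_1^{(1)},\dots,c_m^{(m)})$, and for each $k$-ary $f\in\mathcal F$ and $\mathbf i=(i_1,\dots,i_k)\in[m]^k$ a $k$-ary operation $\hat f_{\mathbf i}(\mathbf c_1,\dots,\mathbf c_k)$: $\mathbf c_1$ with its $f^{\mathbf I}(\mathbf i)$-th entry replaced by $f^{\mathbf A}(c_1^{(i_1)},\dots,c_k^{(i_k)})$. -}

module Defs where

open import Data.Nat using (ℕ; _<_)
open import Data.Fin using (Fin; fromℕ<; _≟_)
open import Data.Vec using (Vec; tabulate; lookup; map)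
open import Data.Vec.Properties using (tabulate∘lookup; tabulate-cong; tabulate-∘)
open import Data.Product using (Σ; _,_; proj₁; proj₂; _×_)
open import Data.Sum using (_⊎_; inj₁; inj₂)
open import Data.Unit using (⊤)
open import Relation.Nullary using (yes; no)
open import Relation.Binary.PropositionalEquality
  using (_≡_; refl; sym; trans; cong)

record Signature : Set₁ where
  field
    Sym   : Set
    arity : Sym → ℕ
open Signature public

NoNullary : Signature → Set
NoNullary F = ∀ f → 0 < arity F f

record Algebra (F : Signature) (X : Set) : Set where
  field
    ⟦_⟧ : (f : Sym F) → Vec X (arity F f) → X
open Algebra public

IsHom : {F : Signature} {X Y : Set} → Algebra F X → Algebra F Y → (X → Y) → Set
IsHom {F} 𝔸 𝔹 h = ∀ (f : Sym F) (xs : Vec _ (arity F f)) →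
  h (⟦ 𝔸 ⟧ f xs) ≡ ⟦ 𝔹 ⟧ f (map h xs)

IsSurjective : {X Y : Set} → (X → Y) → Set
IsSurjective {X} h = ∀ y → Σ X λ x → h x ≡ y

data Term (F : Signature) (K V : Set) : Set where
  var : V → Term F K V
  cst : K → Term F K V
  app : (f : Sym F) → (Fin (arity F f) → Term F K V) → Term F K V

eval : {F : Signature} {X V : Set} → Algebra F X → (V → X) → Term F X V → X
eval 𝔸 x (var v)    = x v
eval 𝔸 x (cst c)    = c
eval 𝔸 x (app f ts) = ⟦ 𝔸 ⟧ f (tabulate λ j → eval 𝔸 x (ts j))

IsPolyOp : {F : Signature} {X V : Set} → Algebra F X → (X → X → Set) →
           ((V → X) → X) → Set
IsPolyOp {F} {X} {V} 𝔸 _≈_ P =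
  Σ (Term F X V) λ t → ∀ (x : V → X) → P x ≈ eval 𝔸 x t

module Construction (F : Signature) (nn : NoNullary F)
                    {A : Set} (𝔸 : Algebra F A)
                    {m : ℕ} (𝕀 : Algebra F (Fin m))
                    (χ : A → Fin m) (hom : IsHom 𝔸 𝕀 χ) where

  D : Fin m → Set
  D i = Σ A λ a → χ a ≡ i

  Col : Set
  Col = (i : Fin m) → D i

  _≈C_ : Col → Col → Set
  c ≈C c' = ∀ i → proj₁ (c i) ≡ proj₁ (c' i)

  -- the language of ℭ: d (m-ary) and f̂_𝐢 for f ∈ F, 𝐢 ∈ [m]^k
  FC : Signature
  FC = record
    { Sym   = ⊤ ⊎ Σ (Sym F) (λ f → Vec (Fin m) (arity F f))
    ; arity = λ { (inj₁ _) → m ; (inj₂ (f , _)) → arity F f } }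

  private
    lemma : (f : Sym F) (𝐢 : Vec (Fin m) (arity F f))
            (cs : Fin (arity F f) → Col) →
            χ (⟦ 𝔸 ⟧ f (tabulate λ t → proj₁ (cs t (lookup 𝐢 t)))) ≡ ⟦ 𝕀 ⟧ f 𝐢
    lemma f 𝐢 cs =
      trans (hom f _)
        (cong (⟦ 𝕀 ⟧ f)
          (trans (sym (tabulate-∘ χ (λ t → proj₁ (cs t (lookup 𝐢 t)))))
            (trans (tabulate-cong (λ t → proj₂ (cs t (lookup 𝐢 t))))
                   (tabulate∘lookup 𝐢))))

  -- f̂_𝐢(𝐜₁,…,𝐜ₖ): 𝐜₁ with its f^𝐈(𝐢)-th entry replaced by
  -- f^𝐀(c₁^(i₁),…,cₖ^(iₖ)).
  hat : (f : Sym F) (𝐢 : Vec (Fin m) (arity F f)) →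
        Vec Col (arity F f) → Col
  hat f 𝐢 cs j with j ≟ ⟦ 𝕀 ⟧ f 𝐢
  ... | yes eq = ⟦ 𝔸 ⟧ f (tabulate λ t → proj₁ (lookup cs t (lookup 𝐢 t)))
               , trans (lemma f 𝐢 (lookup cs)) (sym eq)
  ... | no _   = lookup cs (fromℕ< (nn f)) j

  dop : Vec Col m → Col
  dop cs i = lookup cs i i

  ℭ : Algebra FC Col
  ℭ = record { ⟦_⟧ = λ { (inj₁ _) cs → dop cs ; (inj₂ (f , 𝐢)) cs → hat f 𝐢 cs } }

  entries : {k : ℕ} → (Fin k → Col) → (Fin m × Fin k → A)
  entries a (i , j) = proj₁ (a j i)

module Submission where

open import Defs
open import Data.Nat using (ℕ)
open import Data.Fin using (Fin; fromℕ<; _≟_)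
open import Data.Product using (Σ; _×_; proj₁; proj₂; _,_)
open import Data.Sum using (inj₁; inj₂)
open import Data.Unit using (tt)
open import Data.Vec using (Vec; tabulate; lookup; map)
open import Data.Vec.Properties using (lookup∘tabulate; tabulate-cong; tabulate-∘)
open import Relation.Nullary using (yes; no; contradiction)
open import Relation.Binary.PropositionalEquality
  using (_≡_; refl; sym; trans; cong; subst; module ≡-Reasoning)
open import Function.Bundles using (_⇔_; mk⇔)

-- A term of ℭ is computed row by row: in row i, d reads its i-th argument and
-- f̂_𝐢 either applies f to the rows 𝐢 (when i = f^𝐈(𝐢)) or copies its first
-- argument, which yields m polynomials of 𝐀. Conversely, a polynomial of 𝐀
-- landing in D⁽ⁱ⁾ on C-matrices has row index i (its value in 𝐈 with row-i
-- variables sent to i), so it is the i-th row of a term of ℭ built from f̂ with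
-- the row indices of its subterms; d then assembles the m rows.
module ColumnPolynomials (F : Signature) (nn : NoNullary F)
    {A : Set} (𝔸 : Algebra F A) {m : ℕ} (𝕀 : Algebra F (Fin m))
    (χ : A → Fin m) (hom : IsHom 𝔸 𝕀 χ) (k : ℕ) where

  open Construction F nn 𝔸 𝕀 χ hom

  Entry : Set
  Entry = Fin m × Fin k

  ComponentwisePolynomial : ((Fin k → Col) → Col) → Set
  ComponentwisePolynomial P =
    Σ (Fin m → ((Entry → A) → A)) λ p →
      (∀ i → IsPolyOp 𝔸 _≡_ (p i))
      × (∀ (a : Fin k → Col) →
           (∀ i → χ (p i (entries a)) ≡ i)
           × (∀ i → proj₁ (P a i) ≡ p i (entries a)))

  entry-lookup-tabulate : ∀ {n} (cs : Fin n → Col) (t : Fin n) (i : Fin m) →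
    proj₁ (lookup (tabulate cs) t i) ≡ proj₁ (cs t i)
  entry-lookup-tabulate cs t i = cong (λ c → proj₁ (c i)) (lookup∘tabulate cs t)

  row : Term FC Col (Fin k) → Fin m → Term F A Entry
  row (var j)                 i = var (i , j)
  row (cst c)                 i = cst (proj₁ (c i))
  row (app (inj₁ _) ts)       i = row (ts i) i
  row (app (inj₂ (f , 𝐢)) ts) i with i ≟ ⟦ 𝕀 ⟧ f 𝐢
  ... | yes _ = app f (λ t → row (ts t) (lookup 𝐢 t))
  ... | no  _ = row (ts (fromℕ< (nn f))) i

  eval-row : (a : Fin k → Col) (t : Term FC Col (Fin k)) (i : Fin m) →
    proj₁ (eval ℭ a t i) ≡ eval 𝔸 (entries a) (row t i)
  eval-row a (var j) i = refl
  eval-row a (cst c) i = refl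
  eval-row a (app (inj₁ _) ts) i =
    trans (entry-lookup-tabulate (λ j → eval ℭ a (ts j)) i i) (eval-row a (ts i) i)
  eval-row a (app (inj₂ (f , 𝐢)) ts) i with i ≟ ⟦ 𝕀 ⟧ f 𝐢
  ... | yes _ = cong (⟦ 𝔸 ⟧ f) (tabulate-cong λ t →
          trans (entry-lookup-tabulate (λ j → eval ℭ a (ts j)) t (lookup 𝐢 t))
                (eval-row a (ts t) (lookup 𝐢 t)))
  ... | no  _ = trans (entry-lookup-tabulate (λ j → eval ℭ a (ts j)) (fromℕ< (nn f)) i)
                      (eval-row a (ts (fromℕ< (nn f))) i)

  polyOp⇒componentwise : ∀ P → IsPolyOp ℭ _≈C_ P → ComponentwisePolynomial P
  polyOp⇒componentwise P (t , P≈t) =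
    (λ i x → eval 𝔸 x (row t i)) , (λ i → row t i , λ _ → refl) ,
    λ a → (λ i → subst (λ z → χ z ≡ i) (P≡row a i) (proj₂ (P a i))) , P≡row a
    where
    P≡row : ∀ a i → proj₁ (P a i) ≡ eval 𝔸 (entries a) (row t i)
    P≡row a i = trans (P≈t a i) (eval-row a t i)

  rowIndex : Term F A Entry → Fin m
  rowIndex (var (i , _)) = i
  rowIndex (cst c)       = χ c
  rowIndex (app f ss)    = ⟦ 𝕀 ⟧ f (tabulate λ t → rowIndex (ss t))

  χ-eval≡rowIndex : (x : Entry → A) → (∀ e → χ (x e) ≡ proj₁ e) →
    (s : Term F A Entry) → χ (eval 𝔸 x s) ≡ rowIndex s
  χ-eval≡rowIndex x χx (var e)    = χx e
  χ-eval≡rowIndex x χx (cst c)    = refl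
  χ-eval≡rowIndex x χx (app f ss) = begin
    χ (⟦ 𝔸 ⟧ f (tabulate λ t → eval 𝔸 x (ss t)))       ≡⟨ hom f _ ⟩
    ⟦ 𝕀 ⟧ f (map χ (tabulate λ t → eval 𝔸 x (ss t)))
      ≡⟨ cong (⟦ 𝕀 ⟧ f) (sym (tabulate-∘ χ (λ t → eval 𝔸 x (ss t)))) ⟩
    ⟦ 𝕀 ⟧ f (tabulate λ t → χ (eval 𝔸 x (ss t)))
      ≡⟨ cong (⟦ 𝕀 ⟧ f) (tabulate-cong λ t → χ-eval≡rowIndex x χx (ss t)) ⟩
    rowIndex (app f ss)                                 ∎
    where open ≡-Reasoning

  hat-target : (f : Sym F) (𝐢 : Vec (Fin m) (arity F f)) (cs : Vec Col (arity F f)) →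
    proj₁ (hat f 𝐢 cs (⟦ 𝕀 ⟧ f 𝐢))
      ≡ ⟦ 𝔸 ⟧ f (tabulate λ t → proj₁ (lookup cs t (lookup 𝐢 t)))
  hat-target f 𝐢 cs with ⟦ 𝕀 ⟧ f 𝐢 ≟ ⟦ 𝕀 ⟧ f 𝐢
  ... | yes _ = refl
  ... | no ne = contradiction refl ne

  module _ (surj : IsSurjective χ) where

    -- The other entries are arbitrary; χ being onto makes each D⁽ʲ⁾ nonempty.
    columnThrough : A → Col
    columnThrough c j with j ≟ χ c
    ... | yes eq = c , sym eq
    ... | no  _  = surj j

    columnThrough-at-χ : (c : A) → proj₁ (columnThrough c (χ c)) ≡ c
    columnThrough-at-χ c with χ c ≟ χ c
    ... | yes _ = refl
    ... | no ne = contradiction refl ne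

    columnTerm : Term F A Entry → Term FC Col (Fin k)
    columnTerm (var (_ , j)) = var j
    columnTerm (cst c)       = cst (columnThrough c)
    columnTerm (app f ss)    =
      app (inj₂ (f , tabulate λ t → rowIndex (ss t))) (λ t → columnTerm (ss t))

    eval-columnTerm : (a : Fin k → Col) (s : Term F A Entry) →
      proj₁ (eval ℭ a (columnTerm s) (rowIndex s)) ≡ eval 𝔸 (entries a) s
    eval-columnTerm a (var _)    = refl
    eval-columnTerm a (cst c)    = columnThrough-at-χ c
    eval-columnTerm a (app f ss) =
      trans (hat-target f 𝐢 (tabulate cs)) (cong (⟦ 𝔸 ⟧ f) (tabulate-cong λ t →
        trans (entry-lookup-tabulate cs t (lookup 𝐢 t))
          (trans (cong (λ r → proj₁ (cs t r)) (lookup∘tabulate (λ t → rowIndex (ss t)) t))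
                 (eval-columnTerm a (ss t)))))
      where
      𝐢 : Vec (Fin m) (arity F f)
      𝐢 = tabulate λ t → rowIndex (ss t)
      cs : Fin (arity F f) → Col
      cs j = eval ℭ a (columnTerm (ss j))

    sampleMatrix : Fin k → Col
    sampleMatrix _ = surj

    componentwise⇒polyOp : ∀ P → ComponentwisePolynomial P → IsPolyOp ℭ _≈C_ P
    componentwise⇒polyOp P (p , p-poly , p-spec) =
      app (inj₁ tt) (λ i → columnTerm (s i)) , λ a i →
        begin
          proj₁ (P a i)                                 ≡⟨ proj₂ (p-spec a) i ⟩
          p i (entries a)                               ≡⟨ proj₂ (p-poly i) (entries a) ⟩
          eval 𝔸 (entries a) (s i)                      ≡⟨ sym (eval-columnTerm a (s i)) ⟩
          proj₁ (eval ℭ a (columnTerm (s i)) (rowIndex (s i)))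
            ≡⟨ cong (λ r → proj₁ (eval ℭ a (columnTerm (s i)) r)) (rowIndex-s i) ⟩
          proj₁ (eval ℭ a (columnTerm (s i)) i)
            ≡⟨ sym (entry-lookup-tabulate (λ j → eval ℭ a (columnTerm (s j))) i i) ⟩
          proj₁ (eval ℭ a (app (inj₁ tt) (λ j → columnTerm (s j))) i) ∎
      where
      open ≡-Reasoning
      s : Fin m → Term F A Entry
      s i = proj₁ (p-poly i)
      rowIndex-s : ∀ i → rowIndex (s i) ≡ i
      rowIndex-s i = begin
        rowIndex (s i)                 ≡⟨ sym (χ-eval≡rowIndex x₀ χx₀ (s i)) ⟩
        χ (eval 𝔸 x₀ (s i))            ≡⟨ cong χ (sym (proj₂ (p-poly i) x₀)) ⟩
        χ (p i x₀)                     ≡⟨ proj₁ (p-spec sampleMatrix) i ⟩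
        i                              ∎
        where
        x₀ : Entry → A
        x₀ = entries sampleMatrix
        χx₀ : ∀ e → χ (x₀ e) ≡ proj₁ e
        χx₀ (i , _) = proj₂ (surj i)

corollary3p10 : (F : Signature) (nn : NoNullary F)
    {A : Set} (𝔸 : Algebra F A) {m : ℕ} (𝕀 : Algebra F (Fin m))
    (χ : A → Fin m) (hom : IsHom 𝔸 𝕀 χ) → IsSurjective χ →
    let open Construction F nn 𝔸 𝕀 χ hom in
    (k : ℕ) (P : (Fin k → Col) → Col) →
    IsPolyOp ℭ _≈C_ P
      ⇔ Σ (Fin m → ((Fin m × Fin k → A) → A)) λ p →
          (∀ i → IsPolyOp 𝔸 _≡_ (p i))
          × (∀ (a : Fin k → Col) →
               (∀ i → χ (p i (entries a)) ≡ i)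
               × (∀ i → proj₁ (P a i) ≡ p i (entries a)))
corollary3p10 F nn 𝔸 𝕀 χ hom surj k P =
  mk⇔ (polyOp⇒componentwise P) (componentwise⇒polyOp surj P)
  where open ColumnPolynomials F nn 𝔸 𝕀 χ hom k
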